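{- Let $X\subseteq\mathbb{N}$ be a pseudorandom set. Then neither $X$ nor its complement $\mathbb{N}\setminus X$ contains a set $A\in\mathbf{P}$ of positive density.
   Context: A sequence $s:\mathbb{N}\to\{\pm1\}$ is pseudorandom if (i) $s$ is computable in nondeterministic polynomial time, meaning that the set $\{n : s(n)=1\}$ belongs to $\mathbf{NP}\cap\mathbf{coNP}$ (with inputs $n$ written in binary), and (ii) for every polynomial time computable function $f:\mathbb{N}\to\{\pm1\}$, $\lim_{n\to\infty}\frac1n\sum_{i=0}^{n-1}f(i)s(i)=0$. A set $X\subseteq\mathbb{N}$ is pseudorandom if $X=\{n : s(n)=1\}$ for a pseudorandom sequence $s$. A set $A\subseteq\mathbb{N}$ has positive density if $\liminf_{n\to\infty}|A\cap[0,n-1]|/n>0$. $\mathbf{P}$ denotes the class of sets of natural numbers decidable in polynomial time (inputs in binary). -}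

module Defs where

open import Data.Nat using (ℕ; zero; suc; _+_; _*_; _^_; _≤_; _<_; _≡ᵇ_)
open import Data.Nat.DivMod using (_/_; _%_)
open import Data.Bool using (Bool; true; false; if_then_else_)
open import Data.List using (List; []; _∷_; _++_; length; reverse)
open import Data.Maybe using (Maybe; just; nothing)
open import Data.Fin using (Fin)
open import Data.Product using (Σ; ∃; _×_; _,_)
open import Data.Sign using (Sign)
open import Data.Integer as ℤ using (ℤ; _◃_; ∣_∣)
open import Relation.Binary.PropositionalEquality using (_≡_)
open import Function.Bundles using (_⇔_)

data Sym : Set where
  blank b0 b1 sep : Sym

data Move : Set where
  L R S : Move

data Action (Q : ℕ) : Set where
  halt : Bool → Action Q
  step : Fin Q → Sym → Move → Action Q

-- A machine with suc q states; state zero is the start state.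
record TM : Set where
  field
    q : ℕ
    δ : Fin (suc q) → Sym → Action (suc q)

-- Tape: reversed cells left of the head, the scanned cell, cells to the right.
record Tape : Set where
  constructor tape
  field
    left  : List Sym
    here  : Sym
    right : List Sym

moveTape : Move → Tape → Tape
moveTape L (tape [] h r)       = tape [] blank (h ∷ r)
moveTape L (tape (x ∷ l) h r)  = tape l x (h ∷ r)
moveTape R (tape l h [])       = tape (h ∷ l) blank []
moveTape R (tape l h (x ∷ r))  = tape (h ∷ l) x r
moveTape S t                   = t

initTape : List Sym → Tape
initTape []       = tape [] blank []
initTape (x ∷ xs) = tape [] x xs

run : (M : TM) → ℕ → Fin (suc (TM.q M)) → Tape → Maybe Bool
run M zero    st tp = nothing
run M (suc t) st (tape l h r) with TM.δ M st h
... | halt b         = just b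
... | step st' w mv  = run M t st' (moveTape mv (tape l w r))

runOn : TM → ℕ → List Sym → Maybe Bool
runOn M t x = run M t Fin.zero (initTape x)

-- Binary encoding of natural numbers (most significant bit first, 0 ↦ "0")

bit : ℕ → Sym
bit n = if (n % 2) ≡ᵇ 0 then b0 else b1

-- least-significant-first digits; the fuel argument (≥ n) ensures termination
lsbDigits : ℕ → ℕ → List Sym
lsbDigits zero    n = []
lsbDigits (suc f) zero = []
lsbDigits (suc f) n@(suc _) = bit n ∷ lsbDigits f (n / 2)

binary : ℕ → List Sym
binary zero        = b0 ∷ []
binary n@(suc _)   = reverse (lsbDigits n n)

data Bit : Set where
  o i : Bit

bitSym : Bit → Sym
bitSym o = b0
bitSym i = b1

bitsSym : List Bit → List Sym
bitsSym []       = []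
bitsSym (x ∷ xs) = bitSym x ∷ bitsSym xs

-- Complexity classes (polynomial bounds written as (|x|+1)^c)

InP : (ℕ → Bool) → Set
InP A = Σ TM λ M → Σ ℕ λ c →
  ∀ n → runOn M (suc (length (binary n)) ^ c) (binary n) ≡ just (A n)

InNP : (ℕ → Set) → Set
InNP P = Σ TM λ M → Σ ℕ λ c → ∀ n →
  P n ⇔ (Σ (List Bit) λ w →
          (length w ≤ suc (length (binary n)) ^ c) ×
          (runOn M (suc (length (binary n)) ^ c)
                   (binary n ++ (sep ∷ bitsSym w)) ≡ just true))

-- sign-valued sequences viewed as ±1
val : Sign → ℤ
val s = s ◃ 1

isPlus : Sign → Bool
isPlus Sign.+ = true
isPlus Sign.- = false

PolyTimeSign : (ℕ → Sign) → Set
PolyTimeSign f = InP (λ n → isPlus (f n))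

corr : (ℕ → Sign) → (ℕ → Sign) → ℕ → ℤ
corr f s zero    = ℤ.+ 0
corr f s (suc n) = corr f s n ℤ.+ (val (f n) ℤ.* val (s n))

-- (1/n) Σ_{i<n} f(i)s(i) → 0, unfolded with ε = 1/k:
-- for every k ≥ 1 there is N with k·|Σ_{i<n} f(i)s(i)| ≤ n for all n ≥ N.
AvgTendsToZero : (ℕ → ℤ) → Set
AvgTendsToZero T = ∀ k → 1 ≤ k → Σ ℕ λ N → ∀ n → N ≤ n → k * ∣ T n ∣ ≤ n

record Pseudorandom (s : ℕ → Sign) : Set where
  field
    inNP   : InNP (λ n → s n ≡ Sign.+)
    inCoNP : InNP (λ n → s n ≡ Sign.-)
    uncorrelated : ∀ (f : ℕ → Sign) → PolyTimeSign f → AvgTendsToZero (corr f s)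

count : (ℕ → Bool) → ℕ → ℕ
count A zero    = 0
count A (suc n) = (if A n then 1 else 0) + count A n

-- liminf |A ∩ [0,n-1]|/n > 0, unfolded: for some k ≥ 1, eventually
-- |A ∩ [0,n-1]|/n ≥ 1/k.
PositiveDensity : (ℕ → Bool) → Set
PositiveDensity A = Σ ℕ λ k → 1 ≤ k × Σ ℕ λ N → ∀ n → N ≤ n → n ≤ k * count A n

-- Test s against the two polynomial-time sequences 1 and ±1_A (the ±1 indicator of A).
-- Since 1 + (±1_A)(i) = 2·[i ∈ A], the two correlation sums add up to 2 Σ_{i<n, i∈A} s(i),
-- which is ±2|A ∩ [0,n)| if s is constant on A. Both sums are o(n), whereas positive density
-- makes |A ∩ [0,n)| grow linearly.
module Submission where

open import Defs
open import Data.Nat using (ℕ)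
open import Data.Bool using (Bool; true)
open import Data.Sign using (Sign)
open import Data.Product using (_×_)
open import Relation.Nullary using (¬_)
open import Relation.Binary.PropositionalEquality using (_≡_)

open import Data.Nat as ℕ using (zero; suc; _≤_; _⊔_)
import Data.Nat.Properties as ℕ
open import Data.Bool using (false; if_then_else_)
open import Data.Product using (_,_)
open import Data.Integer as ℤ using (ℤ; +_; ∣_∣; _◃_)
import Data.Integer.Properties as ℤ
open import Algebra.Properties.CommutativeSemigroup ℤ.+-commutativeSemigroup using (interchange)
open import Data.Maybe using (just)
open import Relation.Binary.PropositionalEquality using (refl; sym; trans; cong; cong₂; module ≡-Reasoning)

toSign : Bool → Sign
toSign b = if b then Sign.+ else Sign.-

isPlus-toSign : ∀ b → isPlus (toSign b) ≡ b
isPlus-toSign true  = refl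
isPlus-toSign false = refl

const+-polyTime : PolyTimeSign (λ _ → Sign.+)
const+-polyTime = record { q = 0 ; δ = λ _ _ → halt true } , 0 , λ _ → refl

toSign-polyTime : ∀ {A} → InP A → PolyTimeSign (λ n → toSign (A n))
toSign-polyTime {A} (M , c , M-decides) =
  M , c , λ n → trans (M-decides n) (cong just (sym (isPlus-toSign (A n))))

AvgTendsToZero-+ : ∀ {T U} → AvgTendsToZero T → AvgTendsToZero U →
                   AvgTendsToZero (λ n → T n ℤ.+ U n)
AvgTendsToZero-+ {T} {U} T→0 U→0 k 1≤k with T→0 (2 ℕ.* k) 1≤2k | U→0 (2 ℕ.* k) 1≤2k
  where 1≤2k = ℕ.≤-trans 1≤k (ℕ.m≤n*m k 2)
... | N₁ , T-small | N₂ , U-small = N₁ ⊔ N₂ , λ n N≤n → ℕ.*-cancelˡ-≤ 2 (begin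
  2 ℕ.* (k ℕ.* ∣ T n ℤ.+ U n ∣)          ≤⟨ ℕ.*-monoʳ-≤ 2 (ℕ.*-monoʳ-≤ k (ℤ.∣i+j∣≤∣i∣+∣j∣ (T n) (U n))) ⟩
  2 ℕ.* (k ℕ.* (∣ T n ∣ ℕ.+ ∣ U n ∣))    ≡⟨ sym (ℕ.*-assoc 2 k _) ⟩
  2 ℕ.* k ℕ.* (∣ T n ∣ ℕ.+ ∣ U n ∣)      ≡⟨ ℕ.*-distribˡ-+ (2 ℕ.* k) (∣ T n ∣) (∣ U n ∣) ⟩
  2 ℕ.* k ℕ.* ∣ T n ∣ ℕ.+ 2 ℕ.* k ℕ.* ∣ U n ∣
    ≤⟨ ℕ.+-mono-≤ (T-small n (ℕ.≤-trans (ℕ.m≤m⊔n N₁ N₂) N≤n))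
                  (U-small n (ℕ.≤-trans (ℕ.m≤n⊔m N₁ N₂) N≤n)) ⟩
  n ℕ.+ n                                ≡⟨ cong (n ℕ.+_) (sym (ℕ.+-identityʳ n)) ⟩
  2 ℕ.* n                                ∎)
  where open ℕ.≤-Reasoning

AvgTendsToZero-dominated : ∀ {T U} → AvgTendsToZero T → (∀ n → ∣ U n ∣ ≤ ∣ T n ∣) →
                           AvgTendsToZero U
AvgTendsToZero-dominated T→0 U≤T k 1≤k with T→0 k 1≤k
... | N , T-small = N , λ n N≤n → ℕ.≤-trans (ℕ.*-monoʳ-≤ k (U≤T n)) (T-small n N≤n)

positiveDensity⇒¬AvgTendsToZero : ∀ {A} → PositiveDensity A →
                                  ¬ AvgTendsToZero (λ n → + count A n)
positiveDensity⇒¬AvgTendsToZero {A} (k , 1≤k , N , dense) count→0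
  with count→0 (2 ℕ.* k) (ℕ.≤-trans 1≤k (ℕ.m≤n*m k 2))
... | M , count-small = ℕ.<⇒≱ (ℕ.m<m+n n ℕ.z<s) (begin
  2 ℕ.* n                    ≤⟨ ℕ.*-monoʳ-≤ 2 (dense n (ℕ.≤-trans (ℕ.m≤m⊔n N M) (ℕ.n≤1+n _))) ⟩
  2 ℕ.* (k ℕ.* count A n)    ≡⟨ sym (ℕ.*-assoc 2 k (count A n)) ⟩
  2 ℕ.* k ℕ.* count A n      ≤⟨ count-small n (ℕ.≤-trans (ℕ.m≤n⊔m N M) (ℕ.n≤1+n _)) ⟩
  n                          ∎)
  where
  n = suc (N ⊔ M)
  open ℕ.≤-Reasoning

1+toSign-correlation : ∀ σ b τ → (b ≡ true → τ ≡ σ) →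
  val Sign.+ ℤ.* val τ ℤ.+ val (toSign b) ℤ.* val τ ≡ σ ◃ (2 ℕ.* (if b then 1 else 0))
1+toSign-correlation Sign.+ true  τ τ≡σ with refl ← τ≡σ refl = refl
1+toSign-correlation Sign.- true  τ τ≡σ with refl ← τ≡σ refl = refl
1+toSign-correlation σ      false Sign.+ _ = refl
1+toSign-correlation σ      false Sign.- _ = refl

corr-const+corr-toSign : ∀ {A s} σ → (∀ n → A n ≡ true → s n ≡ σ) → ∀ n →
  corr (λ _ → Sign.+) s n ℤ.+ corr (λ m → toSign (A m)) s n ≡ σ ◃ (2 ℕ.* count A n)
corr-const+corr-toSign σ s≡σ zero = refl
corr-const+corr-toSign {A} {s} σ s≡σ (suc n) = begin
  (c₁ ℤ.+ x) ℤ.+ (c₂ ℤ.+ y)                        ≡⟨ interchange c₁ x c₂ y ⟩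
  (c₁ ℤ.+ c₂) ℤ.+ (x ℤ.+ y)                        ≡⟨ cong₂ ℤ._+_ (corr-const+corr-toSign σ s≡σ n)
                                                          (1+toSign-correlation σ (A n) (s n) (s≡σ n)) ⟩
  (σ ◃ (2 ℕ.* count A n)) ℤ.+ (σ ◃ (2 ℕ.* a))      ≡⟨ sym (ℤ.◃-distrib-+ σ (2 ℕ.* count A n) (2 ℕ.* a)) ⟩
  σ ◃ (2 ℕ.* count A n ℕ.+ 2 ℕ.* a)                ≡⟨ cong (σ ◃_) (sym (ℕ.*-distribˡ-+ 2 (count A n) a)) ⟩
  σ ◃ (2 ℕ.* (count A n ℕ.+ a))                    ≡⟨ cong (λ m → σ ◃ (2 ℕ.* m)) (ℕ.+-comm (count A n) a) ⟩
  σ ◃ (2 ℕ.* (a ℕ.+ count A n))                    ∎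
  where
  open ≡-Reasoning
  c₁ = corr (λ _ → Sign.+) s n
  c₂ = corr (λ m → toSign (A m)) s n
  x = val Sign.+ ℤ.* val (s n)
  y = val (toSign (A n)) ℤ.* val (s n)
  a = if A n then 1 else 0

¬constantOn : ∀ {s A} → Pseudorandom s → InP A → PositiveDensity A →
              ∀ σ → ¬ (∀ n → A n ≡ true → s n ≡ σ)
¬constantOn {s} {A} s-random A∈P dense σ s≡σ =
  positiveDensity⇒¬AvgTendsToZero dense
    (AvgTendsToZero-dominated {sum} {λ n → + count A n} sum→0 count≤∣sum∣)
  where
  open Pseudorandom s-random
  sum : ℕ → ℤ
  sum n = corr (λ _ → Sign.+) s n ℤ.+ corr (λ m → toSign (A m)) s n
  sum→0 : AvgTendsToZero sum
  sum→0 = AvgTendsToZero-+ {corr (λ _ → Sign.+) s} {corr (λ m → toSign (A m)) s}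
             (uncorrelated _ const+-polyTime) (uncorrelated _ (toSign-polyTime A∈P))
  count≤∣sum∣ : ∀ n → count A n ≤ ∣ sum n ∣
  count≤∣sum∣ n = ℕ.≤-trans (ℕ.m≤n*m (count A n) 2)
    (ℕ.≤-reflexive (sym (trans (cong ∣_∣ (corr-const+corr-toSign σ s≡σ n)) (ℤ.abs-◃ σ _))))

corollary1 : (s : ℕ → Sign) → Pseudorandom s →
    (A : ℕ → Bool) → InP A → PositiveDensity A →
      ¬ (∀ n → A n ≡ true → s n ≡ Sign.+) × ¬ (∀ n → A n ≡ true → s n ≡ Sign.-)
corollary1 s s-random A A∈P dense = ¬constantOn s-random A∈P dense Sign.+
                                  , ¬constantOn s-random A∈P dense Sign.-
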